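{- Let $\mathcal{F}\subsetneq 2^{[n]}$ be an s-extremal family with $\mathcal{F}=\mathcal{F}(\mathcal{S},h)$ and $\mathrm{Sh}(\mathcal{F})=\mathcal{H}(\mathcal{S})$ for some Sperner family $\mathcal{S}\subseteq 2^{[n]}$ and function $h:\mathcal{S}\to 2^{[n]}$ with $h(S)\subseteq S$ for every $S\in\mathcal{S}$. Then there exists $F\in 2^{[n]}\setminus\mathcal{F}$ such that $\mathcal{F}\cup\{F\}$ is s-extremal if and only if there exists $S_0\in\mathcal{S}$ such that $\mathcal{Q}_{S_0,h(S_0)}\not\subseteq\bigcup_{S\in\mathcal{S}\setminus\{S_0\}}\mathcal{Q}_{S,h(S)}$.
   Context: $[n]=\{1,\dots,n\}$. A family $\mathcal{F}\subseteq 2^{[n]}$ shatters $S\subseteq[n]$ if $\{F\cap S: F\in\mathcal{F}\}=2^S$; $\mathrm{Sh}(\mathcal{F})$ is the family of sets shattered by $\mathcal{F}$. $\mathcal{F}$ is s-extremal if $|\mathrm{Sh}(\mathcal{F})|=|\mathcal{F}|$. A Sperner family is a family none of whose members contains another. For $H\subseteq S\subseteq[n]$ let $\mathcal{P}_S=\{S\cup B: B\subseteq [n]\setminus S\}$ and $\mathcal{Q}_{S,H}=\{H\cup B: B\subseteq[n]\setminus S\}$. Define $\mathcal{H}(\mathcal{S})=2^{[n]}\setminus\bigcup_{S\in\mathcal{S}}\mathcal{P}_S$ and $\mathcal{F}(\mathcal{S},h)=2^{[n]}\setminus\bigcup_{S\in\mathcal{S}}\mathcal{Q}_{S,h(S)}$.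 -}

module Defs where

open import Data.Nat using (ℕ; zero; suc; _+_)
open import Data.Bool using (Bool; true; false; not; _∧_; _∨_; if_then_else_; T)
import Data.Bool.Properties as BP
open import Data.List using (List; []; _∷_; _++_; map)
open import Data.Bool.ListAction using (any; all)
open import Data.Nat.ListAction using (sum)
open import Data.Vec using (Vec; []; _∷_)
open import Data.Vec.Properties using (≡-dec)
open import Data.Fin.Subset using (Subset; _⊆_; _∩_; _∪_; ∁)
open import Data.Fin.Subset.Properties using (_⊆?_)
open import Relation.Nullary.Decidable using (⌊_⌋)
open import Relation.Binary.PropositionalEquality using (_≡_)

allSubsets : (n : ℕ) → List (Subset n)
allSubsets zero    = [] ∷ []
allSubsets (suc n) = map (true ∷_) (allSubsets n) ++ map (false ∷_) (allSubsets n)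

_==ᵇ_ : {n : ℕ} → Subset n → Subset n → Bool
A ==ᵇ B = ⌊ ≡-dec BP._≟_ A B ⌋

_⊆ᵇ_ : {n : ℕ} → Subset n → Subset n → Bool
A ⊆ᵇ B = ⌊ A ⊆? B ⌋

Fam : ℕ → Set
Fam n = Subset n → Bool

card : {n : ℕ} → Fam n → ℕ
card {n} F = sum (map (λ X → if F X then 1 else 0) (allSubsets n))

-- F shatters S : every A ⊆ S is of the form F ∩ S for some F ∈ F
-- (i.e. {F ∩ S : F ∈ F} = 2^S; the inclusion ⊆ 2^S is automatic).
shatters : {n : ℕ} → Fam n → Subset n → Bool
shatters {n} F S =
  all (λ A → not (A ⊆ᵇ S) ∨ any (λ G → F G ∧ ((G ∩ S) ==ᵇ A)) (allSubsets n)) (allSubsets n)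

Sh : {n : ℕ} → Fam n → Fam n
Sh F S = shatters F S

sExtremal : {n : ℕ} → Fam n → Set
sExtremal F = card (Sh F) ≡ card F

Sperner : {n : ℕ} → Fam n → Set
Sperner 𝒮 = ∀ A B → T (𝒮 A) → T (𝒮 B) → A ⊆ B → A ≡ B

𝒫 : {n : ℕ} → Subset n → Fam n
𝒫 {n} S X = any (λ B → (B ⊆ᵇ ∁ S) ∧ (X ==ᵇ (S ∪ B))) (allSubsets n)

𝒬 : {n : ℕ} → Subset n → Subset n → Fam n
𝒬 {n} S H X = any (λ B → (B ⊆ᵇ ∁ S) ∧ (X ==ᵇ (H ∪ B))) (allSubsets n)

ℋ : {n : ℕ} → Fam n → Fam n
ℋ {n} 𝒮 X = not (any (λ S → 𝒮 S ∧ 𝒫 S X) (allSubsets n))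

ℱ[_,_] : {n : ℕ} → Fam n → (Subset n → Subset n) → Fam n
ℱ[_,_] {n} 𝒮 h X = not (any (λ S → 𝒮 S ∧ 𝒬 S (h S) X) (allSubsets n))

insert : {n : ℕ} → Fam n → Subset n → Fam n
insert F G X = F X ∨ (X ==ᵇ G)

module Submission where

-- Since Sh(F) = ℋ(𝒮), the members of 𝒮 are exactly the minimal sets not
-- shattered by F, and F = ℱ(𝒮,h) misses the trace h(S) on every S ∈ 𝒮.
-- The general fact behind the proof is that an extremal family misses at
-- most one trace on a minimal non-shattered set; it is proved, together with
-- Pajor's lemma |F| ≤ |Sh F|, by induction on n, splitting a family into its
-- two slices along the first coordinate.  Consequently, adding G to F makes
-- a set Y newly shattered iff Y ∈ 𝒮 and G has trace h(Y) on Y.  If G lies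
-- in exactly one Q_{S₀,h(S₀)}, then Sh(F ∪ {G}) = Sh F ∪ {S₀} and F ∪ {G}
-- is s-extremal; if G lies in two of them, F ∪ {G} shatters two new sets,
-- which is too many.

open import Defs
open import Data.Nat using (ℕ; zero; suc; _+_; _≤_; z≤n)
open import Data.Nat.Properties
  using (≤-refl; ≤-trans; ≤-reflexive; <-irrefl; +-mono-≤; +-monoˡ-≤; +-monoʳ-≤;
         +-cancelˡ-≤; +-cancelʳ-≤; +-comm; +-suc; +-identityʳ; +-commutativeSemigroup; module ≤-Reasoning)
open import Algebra.Properties.CommutativeSemigroup +-commutativeSemigroup using (interchange)
open import Data.Bool using (Bool; true; false; T; not; _∧_; _∨_; if_then_else_)
import Data.Bool.Properties as Bool
open import Data.Bool.ListAction using (any; all)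
open import Data.Nat.ListAction using (sum)
open import Data.Nat.ListAction.Properties using (sum-++)
open import Data.List using (List; _++_; map)
open import Data.List.Properties using (map-++; map-∘)
open import Data.List.Membership.Propositional using (lose) renaming (_∈_ to _∈ˡ_)
open import Data.List.Membership.Propositional.Properties using (∈-map⁺; ∈-++⁺ˡ; ∈-++⁺ʳ)
open import Data.List.Relation.Unary.Any using (here; satisfied)
open import Data.List.Relation.Unary.Any.Properties using (any⁺; any⁻)
import Data.List.Relation.Unary.All as All
open import Data.List.Relation.Unary.All.Properties using (all⁺; all⁻)
open import Data.Vec using ([]; _∷_)
import Data.Vec as Vec
open import Data.Vec.Properties using (∷-injectiveˡ; ∷-injectiveʳ; ≡-dec)
open import Data.Fin.Subset using (Subset; _⊆_; _∩_; _∪_; ∁; ⊥; ⊤)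
open import Data.Fin.Subset.Properties
  using (⊆-refl; ⊆-trans; ⊆-antisym; drop-∷-⊆; out⊆; in⊆in; p∩q⊆p; p∩q⊆q; q⊆p∪q; x∈p∪q⁻;
         ∩-idem;
         ∩-assoc; ∩-comm; ∩-identityʳ; ∩-zeroʳ; ∩-inverseˡ; ∩-distribˡ-∪; ∩-distribʳ-∪;
         ∪-identityʳ; ∪-inverseʳ)
open import Data.Product using (_×_; _,_; proj₁; proj₂; ∃-syntax)
open import Data.Sum using (_⊎_; inj₁; inj₂; [_,_])
open import Data.Unit using (tt)
open import Data.Empty using (⊥-elim)
open import Relation.Nullary using (¬_; Dec; yes; no)
open import Relation.Nullary.Decidable using (toWitness; fromWitness; T?; map′; decidable-stable)
open import Relation.Binary.PropositionalEquality
  using (_≡_; _≢_; refl; sym; trans; cong; cong₂; subst; subst₂; module ≡-Reasoning)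
open import Function.Bundles using (_⇔_; mk⇔; Equivalence)
open import Function.Base using (_∘_)

private
  variable
    n : ℕ

T-not⁺ : ∀ {b} → ¬ T b → T (not b)
T-not⁺ {true}  ¬b = ¬b tt
T-not⁺ {false} _  = tt

T-not⁻ : ∀ {b} → T (not b) → ¬ T b
T-not⁻ {true} ()

T-ext : ∀ {a b} → (T a → T b) → (T b → T a) → a ≡ b
T-ext {true}  {true}  _ _ = refl
T-ext {true}  {false} f _ with f tt
... | ()
T-ext {false} {true}  _ g with g tt
... | ()
T-ext {false} {false} _ _ = refl

T-imp⁺ : ∀ {a b} → (T a → T b) → T (not a ∨ b)
T-imp⁺ {true}  f = f tt
T-imp⁺ {false} _ = tt

T-imp⁻ : ∀ {a b} → T (not a ∨ b) → T a → T b
T-imp⁻ {true} b _ = b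

T-∧⁺ : ∀ {a b} → T a → T b → T (a ∧ b)
T-∧⁺ ta tb = Equivalence.from Bool.T-∧ (ta , tb)

T-∧⁻ : ∀ {a b} → T (a ∧ b) → T a × T b
T-∧⁻ = Equivalence.to Bool.T-∧

T-∨⁻ : ∀ {a b} → T (a ∨ b) → T a ⊎ T b
T-∨⁻ = Equivalence.to Bool.T-∨

T-∨ˡ : ∀ {a b} → T a → T (a ∨ b)
T-∨ˡ ta = Equivalence.from Bool.T-∨ (inj₁ ta)

T-∨ʳ : ∀ {a b} → T b → T (a ∨ b)
T-∨ʳ tb = Equivalence.from Bool.T-∨ (inj₂ tb)

∈-allSubsets : (X : Subset n) → X ∈ˡ allSubsets n
∈-allSubsets []          = here refl
∈-allSubsets (true ∷ X)  = ∈-++⁺ˡ (∈-map⁺ (true ∷_) (∈-allSubsets X))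
∈-allSubsets {suc n} (false ∷ X) =
  ∈-++⁺ʳ (map (true ∷_) (allSubsets n)) (∈-map⁺ (false ∷_) (∈-allSubsets X))

anySubset⁺ : (p : Subset n → Bool) (X : Subset n) → T (p X) → T (any p (allSubsets n))
anySubset⁺ p X pX = any⁺ p (lose (∈-allSubsets X) pX)

anySubset⁻ : (p : Subset n → Bool) → T (any p (allSubsets n)) → ∃[ X ] T (p X)
anySubset⁻ {n} p t = satisfied (any⁻ p (allSubsets n) t)

allSubset⁺ : (p : Subset n → Bool) → (∀ X → T (p X)) → T (all p (allSubsets n))
allSubset⁺ {n} p f = all⁻ p {allSubsets n} (All.tabulate (λ {X} _ → f X))

allSubset⁻ : (p : Subset n → Bool) → T (all p (allSubsets n)) → ∀ X → T (p X)
allSubset⁻ p t X = All.lookup (all⁺ p _ t) (∈-allSubsets X)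

==ᵇ⁺ : {A B : Subset n} → A ≡ B → T (A ==ᵇ B)
==ᵇ⁺ = fromWitness

==ᵇ⁻ : {A B : Subset n} → T (A ==ᵇ B) → A ≡ B
==ᵇ⁻ = toWitness

⊆ᵇ⁺ : {A B : Subset n} → A ⊆ B → T (A ⊆ᵇ B)
⊆ᵇ⁺ A⊆B = fromWitness (λ {x} → A⊆B {x})

⊆ᵇ⁻ : {A B : Subset n} → T (A ⊆ᵇ B) → A ⊆ B
⊆ᵇ⁻ t {x} = toWitness t {x}

⊆⇒∩≡ : {A B : Subset n} → A ⊆ B → A ∩ B ≡ A
⊆⇒∩≡ {A = []}        {[]}        _   = refl
⊆⇒∩≡ {A = false ∷ A} {_ ∷ B}     A⊆B = cong (false ∷_) (⊆⇒∩≡ (drop-∷-⊆ A⊆B))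
⊆⇒∩≡ {A = true ∷ A}  {true ∷ B}  A⊆B = cong (true ∷_) (⊆⇒∩≡ (drop-∷-⊆ A⊆B))
⊆⇒∩≡ {A = true ∷ A}  {false ∷ B} A⊆B with A⊆B Vec.here
... | ()

∪-least : {A B C : Subset n} → A ⊆ C → B ⊆ C → A ∪ B ⊆ C
∪-least {A = A} {B} A⊆C B⊆C x∈A∪B = [ A⊆C , B⊆C ] (x∈p∪q⁻ A B x∈A∪B)

⊆∁⇒disjoint : {B S : Subset n} → B ⊆ ∁ S → B ∩ S ≡ ⊥
⊆∁⇒disjoint {B = B} {S} B⊆∁S = begin
  B ∩ S           ≡⟨ cong (_∩ S) (sym (⊆⇒∩≡ B⊆∁S)) ⟩
  (B ∩ ∁ S) ∩ S   ≡⟨ ∩-assoc B (∁ S) S ⟩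
  B ∩ (∁ S ∩ S)   ≡⟨ cong (B ∩_) (∩-inverseˡ S) ⟩
  B ∩ ⊥           ≡⟨ ∩-zeroʳ B ⟩
  ⊥               ∎
  where open ≡-Reasoning

∩-split : (X S : Subset n) → X ≡ (X ∩ S) ∪ (X ∩ ∁ S)
∩-split X S = begin
  X                       ≡⟨ sym (∩-identityʳ X) ⟩
  X ∩ ⊤                   ≡⟨ cong (X ∩_) (sym (∪-inverseʳ S)) ⟩
  X ∩ (S ∪ ∁ S)           ≡⟨ ∩-distribˡ-∪ X S (∁ S) ⟩
  (X ∩ S) ∪ (X ∩ ∁ S)     ∎
  where open ≡-Reasoning

∪-outside-∩ : {H B S : Subset n} → H ⊆ S → B ⊆ ∁ S → (H ∪ B) ∩ S ≡ H
∪-outside-∩ {H = H} {B} {S} H⊆S B⊆∁S = begin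
  (H ∪ B) ∩ S           ≡⟨ ∩-distribʳ-∪ S H B ⟩
  (H ∩ S) ∪ (B ∩ S)     ≡⟨ cong₂ _∪_ (⊆⇒∩≡ H⊆S) (⊆∁⇒disjoint B⊆∁S) ⟩
  H ∪ ⊥                 ≡⟨ ∪-identityʳ H ⟩
  H                     ∎
  where open ≡-Reasoning

∩-∩-⊆ : (X : Subset n) {S Y : Subset n} → S ⊆ Y → (X ∩ Y) ∩ S ≡ X ∩ S
∩-∩-⊆ X {S} {Y} S⊆Y = begin
  (X ∩ Y) ∩ S   ≡⟨ ∩-assoc X Y S ⟩
  X ∩ (Y ∩ S)   ≡⟨ cong (X ∩_) (trans (∩-comm Y S) (⊆⇒∩≡ S⊆Y)) ⟩
  X ∩ S         ∎
  where open ≡-Reasoning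

outside-⊆⇒≡ : {S Y : Subset n} → S ⊆ Y → Y ∩ ∁ S ⊆ S → Y ≡ S
outside-⊆⇒≡ {S = S} {Y} S⊆Y out⊆S = begin
  Y                       ≡⟨ ∩-split Y S ⟩
  (Y ∩ S) ∪ (Y ∩ ∁ S)     ≡⟨ cong₂ _∪_ (trans (∩-comm Y S) (⊆⇒∩≡ S⊆Y)) outside-empty ⟩
  S ∪ ⊥                   ≡⟨ ∪-identityʳ S ⟩
  S                       ∎
  where
    open ≡-Reasoning
    outside-empty : Y ∩ ∁ S ≡ ⊥
    outside-empty = trans (sym (⊆⇒∩≡ out⊆S)) (⊆∁⇒disjoint (p∩q⊆q Y (∁ S)))

_⊑_ : Fam n → Fam n → Set
F ⊑ G = ∀ X → T (F X) → T (G X)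

Trace : Fam n → Subset n → Subset n → Set
Trace F S A = ∃[ G ] (T (F G) × G ∩ S ≡ A)

Shatters : Fam n → Subset n → Set
Shatters F S = ∀ A → A ⊆ S → Trace F S A

module _ {F : Fam n} {S : Subset n} where

  private
    traceᵇ : Subset n → Bool
    traceᵇ A = any (λ G → F G ∧ ((G ∩ S) ==ᵇ A)) (allSubsets n)

  trace⁺ : ∀ {A} → Trace F S A → T (traceᵇ A)
  trace⁺ (G , G∈F , G∩S≡A) = anySubset⁺ _ G (T-∧⁺ G∈F (==ᵇ⁺ G∩S≡A))

  trace⁻ : ∀ {A} → T (traceᵇ A) → Trace F S A
  trace⁻ t with anySubset⁻ _ t
  ... | G , p = G , proj₁ (T-∧⁻ p) , ==ᵇ⁻ (proj₂ (T-∧⁻ {F G} p))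

  trace? : (A : Subset n) → Dec (Trace F S A)
  trace? A = map′ trace⁻ trace⁺ (T? (traceᵇ A))

  Sh⁺ : Shatters F S → T (Sh F S)
  Sh⁺ shat = allSubset⁺ _ (λ A → T-imp⁺ (λ A⊆ᵇS → trace⁺ (shat A (⊆ᵇ⁻ A⊆ᵇS))))

  Sh⁻ : T (Sh F S) → Shatters F S
  Sh⁻ t A A⊆S = trace⁻ (T-imp⁻ (allSubset⁻ _ t A) (⊆ᵇ⁺ A⊆S))

Trace-mono : {F G : Fam n} {S A : Subset n} → F ⊑ G → Trace F S A → Trace G S A
Trace-mono F⊑G (X , X∈F , X∩S≡A) = X , F⊑G X X∈F , X∩S≡A

Shatters-mono : {F G : Fam n} {S : Subset n} → F ⊑ G → Shatters F S → Shatters G S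
Shatters-mono F⊑G shat A A⊆S = Trace-mono F⊑G (shat A A⊆S)

Sh-mono : {F G : Fam n} → F ⊑ G → Sh F ⊑ Sh G
Sh-mono F⊑G S t = Sh⁺ (Shatters-mono F⊑G (Sh⁻ t))

𝒬⁺ : {S H X : Subset n} → X ∩ S ≡ H → T (𝒬 S H X)
𝒬⁺ {S = S} {H} {X} X∩S≡H =
  anySubset⁺ _ (X ∩ ∁ S)
    (T-∧⁺ (⊆ᵇ⁺ (p∩q⊆q X (∁ S))) (==ᵇ⁺ (trans (∩-split X S) (cong (_∪ (X ∩ ∁ S)) X∩S≡H))))

𝒬⁻ : {S H X : Subset n} → H ⊆ S → T (𝒬 S H X) → X ∩ S ≡ H
𝒬⁻ {S = S} {H} {X} H⊆S t with anySubset⁻ _ t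
... | B , p = trans (cong (_∩ S) (==ᵇ⁻ (proj₂ (T-∧⁻ {B ⊆ᵇ ∁ S} p))))
                    (∪-outside-∩ H⊆S (⊆ᵇ⁻ (proj₁ (T-∧⁻ p))))

-- P_S = Q_{S,S} is the up-set of S.
𝒫⁺ : (S : Subset n) → T (𝒫 S S)
𝒫⁺ S = 𝒬⁺ (∩-idem S)

𝒫⁻ : {S X : Subset n} → T (𝒫 S X) → S ⊆ X
𝒫⁻ {S = S} {X} t = subst (_⊆ X) (𝒬⁻ ⊆-refl t) (p∩q⊆p X S)

module _ (𝒮 p : Subset n → Bool) where

  private
    none : Bool
    none = not (any (λ S → 𝒮 S ∧ p S) (allSubsets n))

  none⁺ : (∀ S → T (𝒮 S) → ¬ T (p S)) → T none
  none⁺ f = T-not⁺ (λ t → let (S , q) = anySubset⁻ _ t in f S (proj₁ (T-∧⁻ q)) (proj₂ (T-∧⁻ {𝒮 S} q)))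

  none⁻ : T none → ∀ S → T (𝒮 S) → ¬ T (p S)
  none⁻ t S S∈𝒮 pS = T-not⁻ t (anySubset⁺ _ S (T-∧⁺ S∈𝒮 pS))

  some : ¬ T none → ∃[ S ] (T (𝒮 S) × T (p S))
  some ¬t with any (λ S → 𝒮 S ∧ p S) (allSubsets n) in eq
  ... | false = ⊥-elim (¬t tt)
  ... | true  = let (S , q) = anySubset⁻ _ (subst T (sym eq) tt) in S , T-∧⁻ q

module _ {F : Fam n} {G : Subset n} where

  insert-⊒ : F ⊑ insert F G
  insert-⊒ X = T-∨ˡ

  insert-new : T (insert F G G)
  insert-new = T-∨ʳ {F G} (==ᵇ⁺ refl)

  insert⁻ : ∀ {X} → T (insert F G X) → T (F X) ⊎ X ≡ G
  insert⁻ {X} t with T-∨⁻ {F X} t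
  ... | inj₁ X∈F = inj₁ X∈F
  ... | inj₂ X≡G = inj₂ (==ᵇ⁻ X≡G)

  insert-old : ∀ {X} → X ≢ G → insert F G X ≡ F X
  insert-old {X} X≢G = T-ext (λ t → [ (λ X∈F → X∈F) , (λ X≡G → ⊥-elim (X≢G X≡G)) ] (insert⁻ t)) T-∨ˡ

slice : Bool → Fam (suc n) → Fam n
slice b F X = F (b ∷ X)

_∪ᶠ_ : Fam n → Fam n → Fam n
(F ∪ᶠ G) X = F X ∨ G X

_∩ᶠ_ : Fam n → Fam n → Fam n
(F ∩ᶠ G) X = F X ∧ G X

count : Fam n → ℕ
count {zero}  F = if F [] then 1 else 0
count {suc n} F = count (slice true F) + count (slice false F)

card≡count : (F : Fam n) → card F ≡ count F
card≡count {zero}  F = +-identityʳ _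
card≡count {suc n} F = begin
  sum (map f (map (true ∷_) L ++ map (false ∷_) L))
    ≡⟨ cong sum (map-++ f (map (true ∷_) L) (map (false ∷_) L)) ⟩
  sum (map f (map (true ∷_) L) ++ map f (map (false ∷_) L))
    ≡⟨ sum-++ (map f (map (true ∷_) L)) (map f (map (false ∷_) L)) ⟩
  sum (map f (map (true ∷_) L)) + sum (map f (map (false ∷_) L))
    ≡⟨ cong₂ _+_ (cong sum (sym (map-∘ L))) (cong sum (sym (map-∘ L))) ⟩
  card (slice true F) + card (slice false F)
    ≡⟨ cong₂ _+_ (card≡count (slice true F)) (card≡count (slice false F)) ⟩
  count F ∎
  where
    open ≡-Reasoning
    L : List (Subset n)
    L = allSubsets n
    f : Subset (suc n) → ℕ
    f X = if F X then 1 else 0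

count-cong : {F G : Fam n} → (∀ X → F X ≡ G X) → count F ≡ count G
count-cong {zero}  F≡G = cong (λ b → if b then 1 else 0) (F≡G [])
count-cong {suc n} F≡G = cong₂ _+_ (count-cong (λ X → F≡G (true ∷ X))) (count-cong (λ X → F≡G (false ∷ X)))

count-mono : {F G : Fam n} → F ⊑ G → count F ≤ count G
count-mono {zero} {F} {G} F⊑G with F [] | G [] | F⊑G []
... | false | _     | _ = z≤n
... | true  | true  | _ = ≤-refl
... | true  | false | f with f tt
...   | ()
count-mono {suc n} F⊑G = +-mono-≤ (count-mono (λ X → F⊑G (true ∷ X))) (count-mono (λ X → F⊑G (false ∷ X)))

count-∪∩ : (F G : Fam n) → count (F ∪ᶠ G) + count (F ∩ᶠ G) ≡ count F + count G
count-∪∩ {zero}  F G with F [] | G []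
... | true  | true  = refl
... | true  | false = refl
... | false | true  = refl
... | false | false = refl
count-∪∩ {suc n} F G = begin
  (count (F₁ ∪ᶠ G₁) + count (F₀ ∪ᶠ G₀)) + (count (F₁ ∩ᶠ G₁) + count (F₀ ∩ᶠ G₀))
    ≡⟨ interchange (count (F₁ ∪ᶠ G₁)) _ _ _ ⟩
  (count (F₁ ∪ᶠ G₁) + count (F₁ ∩ᶠ G₁)) + (count (F₀ ∪ᶠ G₀) + count (F₀ ∩ᶠ G₀))
    ≡⟨ cong₂ _+_ (count-∪∩ F₁ G₁) (count-∪∩ F₀ G₀) ⟩
  (count F₁ + count G₁) + (count F₀ + count G₀)
    ≡⟨ interchange (count F₁) _ _ _ ⟩
  (count F₁ + count F₀) + (count G₁ + count G₀) ∎
  where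
    open ≡-Reasoning
    F₁ F₀ G₁ G₀ : Fam n
    F₁ = slice true F
    F₀ = slice false F
    G₁ = slice true G
    G₀ = slice false G

count-saturate : {F G : Fam n} → F ⊑ G → count G ≤ count F → G ⊑ F
count-saturate {zero} {F} {G} F⊑G G≤F [] with F [] | G []
... | true  | _     = λ _ → tt
... | false | false = λ ()
count-saturate {zero} {F} {G} F⊑G () [] | false | true
count-saturate {suc n} {F} {G} F⊑G G≤F (true ∷ X) =
  count-saturate (λ Y → F⊑G (true ∷ Y))
    (+-cancelʳ-≤ _ _ _ (≤-trans G≤F (+-monoʳ-≤ (count (slice true F)) (count-mono (λ Y → F⊑G (false ∷ Y)))))) X
count-saturate {suc n} {F} {G} F⊑G G≤F (false ∷ X) =
  count-saturate (λ Y → F⊑G (false ∷ Y))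
    (+-cancelˡ-≤ _ _ _ (≤-trans G≤F (+-monoˡ-≤ (count (slice false F)) (count-mono (λ Y → F⊑G (true ∷ Y)))))) X

count-add : {F F′ : Fam n} (X₀ : Subset n) → (∀ X → X ≢ X₀ → F′ X ≡ F X) →
            ¬ T (F X₀) → T (F′ X₀) → count F′ ≡ suc (count F)
count-add {zero} {F} {F′} [] _ X₀∉F X₀∈F′ with F [] | F′ []
... | false | true  = refl
... | true  | _     = ⊥-elim (X₀∉F tt)
count-add {zero} [] _ _ () | false | false
count-add {suc n} (true ∷ X₀) same X₀∉F X₀∈F′ =
  cong₂ _+_ (count-add X₀ (λ X X≢X₀ → same (true ∷ X) (X≢X₀ ∘ ∷-injectiveʳ)) X₀∉F X₀∈F′)
            (count-cong (λ X → same (false ∷ X) (λ ())))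
count-add {suc n} {F} (false ∷ X₀) same X₀∉F X₀∈F′ =
  trans (cong₂ _+_ (count-cong (λ X → same (true ∷ X) (λ ())))
                   (count-add X₀ (λ X X≢X₀ → same (false ∷ X) (X≢X₀ ∘ ∷-injectiveʳ)) X₀∉F X₀∈F′))
        (+-suc (count (slice true F)) _)

count-insert : {F : Fam n} {G : Subset n} → ¬ T (F G) → count (insert F G) ≡ suc (count F)
count-insert {F = F} {G} G∉F = count-add G (λ X → insert-old {F = F}) G∉F (insert-new {F = F})

module _ {F : Fam (suc n)} {S : Subset n} where

  private
    F₁ F₀ : Fam n
    F₁ = slice true F
    F₀ = slice false F

  -- A coordinate outside S is invisible: traces of F on false ∷ S are
  -- the traces of the projection F₁ ∪ F₀ on S.
  trace-out⁺ : ∀ {A} → Trace (F₁ ∪ᶠ F₀) S A → Trace F (false ∷ S) (false ∷ A)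
  trace-out⁺ (G , G∈ , G∩S≡A) with T-∨⁻ {F₁ G} G∈
  ... | inj₁ G∈F₁ = true ∷ G , G∈F₁ , cong (false ∷_) G∩S≡A
  ... | inj₂ G∈F₀ = false ∷ G , G∈F₀ , cong (false ∷_) G∩S≡A

  trace-out⁻ : ∀ {A} → Trace F (false ∷ S) (false ∷ A) → Trace (F₁ ∪ᶠ F₀) S A
  trace-out⁻ (true ∷ G , G∈F , e)  = G , T-∨ˡ G∈F , ∷-injectiveʳ e
  trace-out⁻ (false ∷ G , G∈F , e) = G , T-∨ʳ {F₁ G} G∈F , ∷-injectiveʳ e

  -- A coordinate inside S is recorded: traces b ∷ A of F on true ∷ S are
  -- the traces A of the slice b on S.
  trace-in⁺ : ∀ b {A} → Trace (slice b F) S A → Trace F (true ∷ S) (b ∷ A)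
  trace-in⁺ b (G , G∈ , G∩S≡A) = b ∷ G , G∈ , cong₂ _∷_ (Bool.∧-identityʳ b) G∩S≡A

  trace-in⁻ : ∀ {b A} → Trace F (true ∷ S) (b ∷ A) → Trace (slice b F) S A
  trace-in⁻ (true ∷ G , G∈F , e) with ∷-injectiveˡ e
  ... | refl = G , G∈F , ∷-injectiveʳ e
  trace-in⁻ (false ∷ G , G∈F , e) with ∷-injectiveˡ e
  ... | refl = G , G∈F , ∷-injectiveʳ e

  shatters-out⁺ : Shatters (F₁ ∪ᶠ F₀) S → Shatters F (false ∷ S)
  shatters-out⁺ shat (false ∷ A) A⊆ = trace-out⁺ (shat A (drop-∷-⊆ A⊆))
  shatters-out⁺ shat (true ∷ A)  A⊆ with A⊆ Vec.here
  ... | ()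

  shatters-out⁻ : Shatters F (false ∷ S) → Shatters (F₁ ∪ᶠ F₀) S
  shatters-out⁻ shat A A⊆S = trace-out⁻ (shat (false ∷ A) (out⊆ A⊆S))

  shatters-in⁺ : Shatters F₁ S → Shatters F₀ S → Shatters F (true ∷ S)
  shatters-in⁺ shat₁ _     (true ∷ A)  A⊆ = trace-in⁺ true (shat₁ A (drop-∷-⊆ A⊆))
  shatters-in⁺ _     shat₀ (false ∷ A) A⊆ = trace-in⁺ false (shat₀ A (drop-∷-⊆ A⊆))

  shatters-in⁻ : Shatters F (true ∷ S) → Shatters F₁ S × Shatters F₀ S
  shatters-in⁻ shat = (λ A A⊆S → trace-in⁻ (shat (true ∷ A) (in⊆in A⊆S)))
                    , (λ A A⊆S → trace-in⁻ (shat (false ∷ A) (out⊆ A⊆S)))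

  Sh-out : Sh F (false ∷ S) ≡ Sh (F₁ ∪ᶠ F₀) S
  Sh-out = T-ext (λ t → Sh⁺ (shatters-out⁻ (Sh⁻ t))) (λ t → Sh⁺ (shatters-out⁺ (Sh⁻ t)))

  Sh-in : Sh F (true ∷ S) ≡ Sh F₁ S ∧ Sh F₀ S
  Sh-in = T-ext (λ t → let (shat₁ , shat₀) = shatters-in⁻ (Sh⁻ t) in T-∧⁺ (Sh⁺ shat₁) (Sh⁺ shat₀))
                (λ t → let (t₁ , t₀) = T-∧⁻ {Sh F₁ S} t in Sh⁺ (shatters-in⁺ (Sh⁻ t₁) (Sh⁻ t₀)))

count-Sh : (F : Fam (suc n)) →
           count (Sh F) ≡ count (Sh (slice true F) ∩ᶠ Sh (slice false F)) + count (Sh (slice true F ∪ᶠ slice false F))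
count-Sh F = cong₂ _+_ (count-cong (λ S → Sh-in {F = F} {S})) (count-cong (λ S → Sh-out {F = F} {S}))

count-slices : (F : Fam (suc n)) →
               count F ≡ count (slice true F ∩ᶠ slice false F) + count (slice true F ∪ᶠ slice false F)
count-slices F =
  sym (trans (+-comm (count (slice true F ∩ᶠ slice false F)) _) (count-∪∩ (slice true F) (slice false F)))

Sh-∩ᶠ : (F G : Fam n) → Sh (F ∩ᶠ G) ⊑ (Sh F ∩ᶠ Sh G)
Sh-∩ᶠ F G S t =
  T-∧⁺ (Sh-mono (λ X X∈ → proj₁ (T-∧⁻ X∈)) S t) (Sh-mono (λ X X∈ → proj₂ (T-∧⁻ {F X} X∈)) S t)

pajor : (F : Fam n) → count F ≤ count (Sh F)
pajor {zero} F = count-mono {F = F} {Sh F} (λ { [] []∈F → Sh⁺ {F = F} {S = []} (λ { [] _ → [] , []∈F , refl }) })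
pajor {suc n} F = begin
  count F
    ≡⟨ count-slices F ⟩
  count (F₁ ∩ᶠ F₀) + count (F₁ ∪ᶠ F₀)
    ≤⟨ +-mono-≤ (≤-trans (pajor (F₁ ∩ᶠ F₀)) (count-mono (Sh-∩ᶠ F₁ F₀))) (pajor (F₁ ∪ᶠ F₀)) ⟩
  count (Sh F₁ ∩ᶠ Sh F₀) + count (Sh (F₁ ∪ᶠ F₀))
    ≡⟨ sym (count-Sh F) ⟩
  count (Sh F) ∎
  where
    open ≤-Reasoning
    F₁ F₀ : Fam n
    F₁ = slice true F
    F₀ = slice false F

-- F is extremal when it shatters no more sets than it has members; by
-- Pajor's lemma this means |Sh F| = |F|, i.e. F is s-extremal.
Extremal : Fam n → Set
Extremal F = count (Sh F) ≤ count F

squeeze : ∀ {a b c a′ c′} → c ≤ b → b ≤ a → c′ ≤ a′ → a + a′ ≤ c + c′ → a ≤ c × a′ ≤ c′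
squeeze {a} {b} {c} {a′} {c′} c≤b b≤a c′≤a′ sum≤ =
  +-cancelʳ-≤ a′ a c (≤-trans sum≤ (+-monoʳ-≤ c c′≤a′)) ,
  +-cancelˡ-≤ c a′ c′ (≤-trans (+-monoˡ-≤ a′ (≤-trans c≤b b≤a)) sum≤)

record ExtremalSlices (F : Fam (suc n)) : Set where
  field
    union-extremal : Extremal (slice true F ∪ᶠ slice false F)
    inter-extremal : Extremal (slice true F ∩ᶠ slice false F)
    Sh-inter       : (Sh (slice true F) ∩ᶠ Sh (slice false F)) ⊑ Sh (slice true F ∩ᶠ slice false F)

extremal-slices : (F : Fam (suc n)) → Extremal F → ExtremalSlices F
extremal-slices {n} F ext = record
  { union-extremal = proj₂ tight
  ; inter-extremal = ≤-trans b≤a (proj₁ tight)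
  ; Sh-inter       = count-saturate (Sh-∩ᶠ F₁ F₀) (≤-trans (proj₁ tight) (pajor (F₁ ∩ᶠ F₀)))
  }
  where
    F₁ F₀ : Fam n
    F₁ = slice true F
    F₀ = slice false F
    b≤a : count (Sh (F₁ ∩ᶠ F₀)) ≤ count (Sh F₁ ∩ᶠ Sh F₀)
    b≤a = count-mono (Sh-∩ᶠ F₁ F₀)
    total : count (Sh F₁ ∩ᶠ Sh F₀) + count (Sh (F₁ ∪ᶠ F₀)) ≤ count (F₁ ∩ᶠ F₀) + count (F₁ ∪ᶠ F₀)
    total = subst₂ _≤_ (count-Sh F) (count-slices F) ext
    tight : count (Sh F₁ ∩ᶠ Sh F₀) ≤ count (F₁ ∩ᶠ F₀) × count (Sh (F₁ ∪ᶠ F₀)) ≤ count (F₁ ∪ᶠ F₀)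
    tight = squeeze (pajor (F₁ ∩ᶠ F₀)) b≤a (pajor (F₁ ∪ᶠ F₀)) total

ShattersBelow : Fam n → Subset n → Set
ShattersBelow F S = ∀ U → U ⊆ S → U ≢ S → Shatters F U

head-out : {a : Bool} {A S : Subset n} → (a ∷ A) ⊆ (false ∷ S) → a ≡ false
head-out {a = false} _  = refl
head-out {a = true}  A⊆ with A⊆ Vec.here
... | ()

-- Induction on n: a first
-- coordinate outside S passes to the projection F₁ ∪ F₀, one inside S to
-- the intersection F₁ ∩ F₀; both are again extremal.
missing-trace-unique : (F : Fam n) {S A B : Subset n} → Extremal F → ShattersBelow F S →
                       A ⊆ S → B ⊆ S → ¬ Trace F S A → ¬ Trace F S B → A ≡ B
missing-trace-unique {zero} F {[]} {[]} {[]} _ _ _ _ _ _ = refl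
missing-trace-unique {suc n} F {false ∷ S} {a ∷ A} {b ∷ B} ext below A⊆ B⊆ ¬A ¬B
  with head-out A⊆ | head-out B⊆
... | refl | refl =
  cong (false ∷_) (missing-trace-unique (F₁ ∪ᶠ F₀) (ExtremalSlices.union-extremal (extremal-slices F ext))
                     below′ (drop-∷-⊆ A⊆) (drop-∷-⊆ B⊆) (¬A ∘ trace-out⁺) (¬B ∘ trace-out⁺))
  where
    F₁ F₀ : Fam n
    F₁ = slice true F
    F₀ = slice false F
    below′ : ShattersBelow (F₁ ∪ᶠ F₀) S
    below′ U U⊆S U≢S = shatters-out⁻ (below (false ∷ U) (out⊆ U⊆S) (U≢S ∘ ∷-injectiveʳ))
missing-trace-unique {suc n} F {true ∷ S} {a ∷ A} {b ∷ B} ext below A⊆ B⊆ ¬A ¬B =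
  cong₂ _∷_ (heads-agree a b ¬A (subst (λ X → ¬ Trace F (true ∷ S) (b ∷ X)) (sym A≡B) ¬B)) A≡B
  where
    F₁ F₀ : Fam n
    F₁ = slice true F
    F₀ = slice false F
    slices : ExtremalSlices F
    slices = extremal-slices F ext
    ∩ᶠ-⊑ : ∀ c → (F₁ ∩ᶠ F₀) ⊑ slice c F
    ∩ᶠ-⊑ true  X X∈ = proj₁ (T-∧⁻ X∈)
    ∩ᶠ-⊑ false X X∈ = proj₂ (T-∧⁻ {F₁ X} X∈)
    below′ : ShattersBelow (F₁ ∩ᶠ F₀) S
    below′ U U⊆S U≢S =
      let (shat₁ , shat₀) = shatters-in⁻ (below (true ∷ U) (in⊆in U⊆S) (U≢S ∘ ∷-injectiveʳ))
      in Sh⁻ (ExtremalSlices.Sh-inter slices U (T-∧⁺ (Sh⁺ shat₁) (Sh⁺ shat₀)))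
    A≡B : A ≡ B
    A≡B = missing-trace-unique (F₁ ∩ᶠ F₀) (ExtremalSlices.inter-extremal slices) below′
            (drop-∷-⊆ A⊆) (drop-∷-⊆ B⊆) (¬A ∘ trace-in⁺ a ∘ Trace-mono (∩ᶠ-⊑ a))
            (¬B ∘ trace-in⁺ b ∘ Trace-mono (∩ᶠ-⊑ b))
    -- false ∷ S is a proper subset, so A is a trace of F₁ ∪ F₀ on S; hence
    -- true ∷ A and false ∷ A are not both missing.
    projection-trace : Trace (F₁ ∪ᶠ F₀) S A
    projection-trace =
      shatters-out⁻ (below (false ∷ S) (out⊆ ⊆-refl) (λ ())) A (drop-∷-⊆ A⊆)
    false-present : ¬ Trace F (true ∷ S) (true ∷ A) → Trace F (true ∷ S) (false ∷ A)
    false-present ¬₁ with projection-trace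
    ... | G , G∈ , G∩S≡A with T-∨⁻ {F₁ G} G∈
    ...   | inj₁ G∈F₁ = ⊥-elim (¬₁ (trace-in⁺ true (G , G∈F₁ , G∩S≡A)))
    ...   | inj₂ G∈F₀ = trace-in⁺ false (G , G∈F₀ , G∩S≡A)
    heads-agree : ∀ a b → ¬ Trace F (true ∷ S) (a ∷ A) → ¬ Trace F (true ∷ S) (b ∷ A) → a ≡ b
    heads-agree true  true  _  _  = refl
    heads-agree false false _  _  = refl
    heads-agree true  false ¬₁ ¬₀ = ⊥-elim (¬₀ (false-present ¬₁))
    heads-agree false true  ¬₀ ¬₁ = ⊥-elim (¬₀ (false-present ¬₁))

sExtremal⇒count : {F : Fam n} → sExtremal F → count (Sh F) ≡ count F
sExtremal⇒count {F = F} ext = trans (sym (card≡count (Sh F))) (trans ext (card≡count F))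

count⇒sExtremal : {F : Fam n} → count (Sh F) ≡ count F → sExtremal F
count⇒sExtremal {F = F} eq = trans (card≡count (Sh F)) (trans eq (sym (card≡count F)))

_≟ˢ_ : (A B : Subset n) → Dec (A ≡ B)
_≟ˢ_ = ≡-dec Bool._≟_

module Extension {n : ℕ} (F 𝒮 : Fam n) (h : Subset n → Subset n)
  (sperner : Sperner 𝒮) (h⊆ : ∀ S → T (𝒮 S) → h S ⊆ S) (s-extremal : sExtremal F)
  (F≡ℱ : ∀ X → F X ≡ ℱ[ 𝒮 , h ] X) (Sh≡ℋ : ∀ X → Sh F X ≡ ℋ 𝒮 X) where

  F-avoids : ∀ {S X} → T (𝒮 S) → T (F X) → X ∩ S ≢ h S
  F-avoids {S} {X} S∈𝒮 X∈F X∩S≡hS =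
    none⁻ 𝒮 (λ S → 𝒬 S (h S) X) (subst T (F≡ℱ X) X∈F) S S∈𝒮 (𝒬⁺ X∩S≡hS)

  outside-F : ∀ {G} → ¬ T (F G) → ∃[ S ] (T (𝒮 S) × G ∩ S ≡ h S)
  outside-F {G} G∉F with some 𝒮 (λ S → 𝒬 S (h S) G) (λ t → G∉F (subst T (sym (F≡ℱ G)) t))
  ... | S , S∈𝒮 , G∈Q = S , S∈𝒮 , 𝒬⁻ (h⊆ S S∈𝒮) G∈Q

  𝒮-not-shattered : ∀ {S} → T (𝒮 S) → ¬ Shatters F S
  𝒮-not-shattered {S} S∈𝒮 shat =
    none⁻ 𝒮 (λ S′ → 𝒫 S′ S) (subst T (Sh≡ℋ S) (Sh⁺ shat)) S S∈𝒮 (𝒫⁺ S)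

  𝒮-shattered-below : ∀ {S} → T (𝒮 S) → ShattersBelow F S
  𝒮-shattered-below {S} S∈𝒮 U U⊆S U≢S =
    Sh⁻ (subst T (sym (Sh≡ℋ U)) (none⁺ 𝒮 (λ S′ → 𝒫 S′ U) no-member-below))
    where
      -- By Sperner, a member S′ ⊆ U ⊆ S of 𝒮 would be S itself, forcing U = S.
      no-member-below : ∀ S′ → T (𝒮 S′) → ¬ T (𝒫 S′ U)
      no-member-below S′ S′∈𝒮 S′∈P =
        let S′⊆U = 𝒫⁻ S′∈P
            S′≡S = sperner S′ S S′∈𝒮 S∈𝒮 (⊆-trans S′⊆U U⊆S)
        in U≢S (⊆-antisym U⊆S (subst (_⊆ U) S′≡S S′⊆U))

  contains-𝒮 : ∀ {Y} → ¬ Shatters F Y → ∃[ S ] (T (𝒮 S) × S ⊆ Y)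
  contains-𝒮 {Y} ¬shat with some 𝒮 (λ S → 𝒫 S Y) (λ t → ¬shat (Sh⁻ (subst T (sym (Sh≡ℋ Y)) t)))
  ... | S , S∈𝒮 , Y∈P = S , S∈𝒮 , 𝒫⁻ Y∈P

  extremal : Extremal F
  extremal = ≤-reflexive (sExtremal⇒count {F = F} s-extremal)

  𝒮-traces : ∀ {S A} → T (𝒮 S) → A ⊆ S → A ≢ h S → Trace F S A
  𝒮-traces {S} {A} S∈𝒮 A⊆S A≢hS with trace? {F = F} {S} A
  ... | yes A-trace = A-trace
  ... | no  A-missing = ⊥-elim (A≢hS (missing-trace-unique F extremal (𝒮-shattered-below S∈𝒮)
                                        A⊆S (h⊆ S S∈𝒮) A-missing hS-missing))
    where
      hS-missing : ¬ Trace F S (h S)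
      hS-missing (X , X∈F , X∩S≡hS) = F-avoids S∈𝒮 X∈F X∩S≡hS

  module _ {G : Subset n} where

    private
      F′ : Fam n
      F′ = insert F G

    gains : ∀ {S} → T (𝒮 S) → G ∩ S ≡ h S → Shatters F′ S
    gains {S} S∈𝒮 G∩S≡hS A A⊆S with A ≟ˢ h S
    ... | yes A≡hS = G , insert-new {F = F} , trans G∩S≡hS (sym A≡hS)
    ... | no  A≢hS = Trace-mono (insert-⊒ {F = F}) (𝒮-traces S∈𝒮 A⊆S A≢hS)

    shattered-above : ∀ {S Y} → T (𝒮 S) → S ⊆ Y → Shatters F′ Y → Y ≡ S × G ∩ S ≡ h S
    shattered-above {S} {Y} S∈𝒮 S⊆Y shat′ = Y≡S , subst (λ Z → G ∩ Z ≡ h S) Y≡S G∩Y≡hS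
      where
        hS⊆S : h S ⊆ S
        hS⊆S = h⊆ S S∈𝒮
        hS⊆Y : h S ⊆ Y
        hS⊆Y = ⊆-trans hS⊆S S⊆Y
        only-G : ∀ {X} → T (F′ X) → X ∩ S ≡ h S → X ≡ G
        only-G {X} X∈F′ X∩S≡hS =
          [ (λ X∈F → ⊥-elim (F-avoids S∈𝒮 X∈F X∩S≡hS)) , (λ X≡G → X≡G) ] (insert⁻ {F = F} X∈F′)
        forced : ∀ {A} → A ⊆ Y → A ∩ S ≡ h S → G ∩ Y ≡ A
        forced {A} A⊆Y A∩S≡hS =
          let (X , X∈F′ , X∩Y≡A) = shat′ A A⊆Y
              X∩S≡hS = trans (sym (∩-∩-⊆ X S⊆Y)) (trans (cong (_∩ S) X∩Y≡A) A∩S≡hS)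
          in subst (λ Z → Z ∩ Y ≡ A) (only-G X∈F′ X∩S≡hS) X∩Y≡A
        G∩Y≡hS : G ∩ Y ≡ h S
        G∩Y≡hS = forced hS⊆Y (⊆⇒∩≡ hS⊆S)
        -- The trace h(S) ∪ (Y ∖ S) is also G ∩ Y, so Y ∖ S ⊆ h(S) ⊆ S.
        widened : h S ≡ h S ∪ (Y ∩ ∁ S)
        widened = trans (sym G∩Y≡hS)
                        (forced (∪-least hS⊆Y (p∩q⊆p Y (∁ S))) (∪-outside-∩ hS⊆S (p∩q⊆q Y (∁ S))))
        Y≡S : Y ≡ S
        Y≡S = outside-⊆⇒≡ S⊆Y (⊆-trans (q⊆p∪q (h S) (Y ∩ ∁ S)) (subst (_⊆ S) widened hS⊆S))

    gained : ∀ {Y} → Shatters F′ Y → ¬ Shatters F Y → T (𝒮 Y) × G ∩ Y ≡ h Y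
    gained {Y} shat′ ¬shat =
      let (S , S∈𝒮 , S⊆Y) = contains-𝒮 ¬shat
          (Y≡S , G∩S≡hS) = shattered-above S∈𝒮 S⊆Y shat′
      in subst (λ Z → T (𝒮 Z) × G ∩ Z ≡ h Z) (sym Y≡S) (S∈𝒮 , G∩S≡hS)

    insert-Sh : ∀ {𝒜 S} → 𝒜 ⊑ Sh F′ → Shatters F′ S → insert 𝒜 S ⊑ Sh F′
    insert-Sh {𝒜} 𝒜⊑ShF′ shat Y t =
      [ 𝒜⊑ShF′ Y , (λ Y≡S → subst (T ∘ Sh F′) (sym Y≡S) (Sh⁺ shat)) ] (insert⁻ {F = 𝒜} t)

    Sh-insert : ∀ {S₀} → T (𝒮 S₀) → G ∩ S₀ ≡ h S₀ → (∀ S → T (𝒮 S) → S ≢ S₀ → G ∩ S ≢ h S) →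
                ∀ Y → Sh F′ Y ≡ insert (Sh F) S₀ Y
    Sh-insert {S₀} S₀∈𝒮 G∩S₀≡hS₀ elsewhere Y =
      T-ext (λ t → by-cases t (T? (Sh F Y)))
            (insert-Sh (Sh-mono (insert-⊒ {F = F})) (gains S₀∈𝒮 G∩S₀≡hS₀) Y)
      where
        by-cases : T (Sh F′ Y) → Dec (T (Sh F Y)) → T (insert (Sh F) S₀ Y)
        by-cases _ (yes Y∈ShF) = T-∨ˡ Y∈ShF
        by-cases t (no  Y∉ShF) =
          let (Y∈𝒮 , G∩Y≡hY) = gained (Sh⁻ t) (Y∉ShF ∘ Sh⁺)
          in T-∨ʳ {Sh F Y} (==ᵇ⁺ (decidable-stable (Y ≟ˢ S₀) (λ Y≢S₀ → elsewhere Y Y∈𝒮 Y≢S₀ G∩Y≡hY)))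

    unique-cover⇒extremal : ∀ {S₀} → T (𝒮 S₀) → G ∩ S₀ ≡ h S₀ →
                            (∀ S → T (𝒮 S) → S ≢ S₀ → G ∩ S ≢ h S) → sExtremal F′
    unique-cover⇒extremal {S₀} S₀∈𝒮 G∩S₀≡hS₀ elsewhere = count⇒sExtremal {F = F′} (begin
      count (Sh F′)             ≡⟨ count-cong (Sh-insert S₀∈𝒮 G∩S₀≡hS₀ elsewhere) ⟩
      count (insert (Sh F) S₀)  ≡⟨ count-insert {F = Sh F} (𝒮-not-shattered S₀∈𝒮 ∘ Sh⁻) ⟩
      suc (count (Sh F))        ≡⟨ cong suc (sExtremal⇒count {F = F} s-extremal) ⟩
      suc (count F)             ≡⟨ sym (count-insert {F = F} (λ G∈F → F-avoids S₀∈𝒮 G∈F G∩S₀≡hS₀)) ⟩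
      count F′                  ∎)
      where open ≡-Reasoning

    -- If F ∪ {G} is s-extremal, G has trace h(S) on at most one S ∈ 𝒮: two
    -- such sets would both become shattered, but only one set may be gained.
    extremal⇒unique-cover : ¬ T (F G) → sExtremal F′ → ∀ {S₀ S} → T (𝒮 S₀) → G ∩ S₀ ≡ h S₀ →
                            T (𝒮 S) → S ≢ S₀ → G ∩ S ≢ h S
    extremal⇒unique-cover G∉F ext′ {S₀} {S} S₀∈𝒮 G∩S₀≡hS₀ S∈𝒮 S≢S₀ G∩S≡hS = <-irrefl refl (begin
      suc (suc (count (Sh F)))  ≡⟨ sym two-more ⟩
      count ShF∪S₀∪S            ≤⟨ count-mono ShF∪S₀∪S⊑ShF′ ⟩
      count (Sh F′)             ≡⟨ sExtremal⇒count {F = F′} ext′ ⟩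
      count F′                  ≡⟨ count-insert {F = F} G∉F ⟩
      suc (count F)             ≡⟨ cong suc (sym (sExtremal⇒count {F = F} s-extremal)) ⟩
      suc (count (Sh F))        ∎)
      where
        open ≤-Reasoning
        ShF∪S₀∪S : Fam n
        ShF∪S₀∪S = insert (insert (Sh F) S₀) S
        S₀∉ShF : ¬ T (Sh F S₀)
        S₀∉ShF = 𝒮-not-shattered S₀∈𝒮 ∘ Sh⁻
        S∉ShF∪S₀ : ¬ T (insert (Sh F) S₀ S)
        S∉ShF∪S₀ t = [ 𝒮-not-shattered S∈𝒮 ∘ Sh⁻ , S≢S₀ ] (insert⁻ {F = Sh F} t)
        two-more : count ShF∪S₀∪S ≡ suc (suc (count (Sh F)))
        two-more = trans (count-insert {F = insert (Sh F) S₀} S∉ShF∪S₀)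
                         (cong suc (count-insert {F = Sh F} S₀∉ShF))
        ShF∪S₀∪S⊑ShF′ : ShF∪S₀∪S ⊑ Sh F′
        ShF∪S₀∪S⊑ShF′ =
          insert-Sh (insert-Sh (Sh-mono (insert-⊒ {F = F})) (gains S₀∈𝒮 G∩S₀≡hS₀)) (gains S∈𝒮 G∩S≡hS)

-- An extension G lies
-- outside F, hence in some Q_{S₀,h(S₀)}, and in no other; conversely a set
-- of Q_{S₀,h(S₀)} outside all other Q_{S,h(S)} is an extension.
lemma17 : (n : ℕ) (F : Fam n) (𝒮 : Fam n) (h : Subset n → Subset n) →
    Sperner 𝒮 →
    (∀ S → T (𝒮 S) → h S ⊆ S) →
    (∃[ X ] T (not (F X))) →
    sExtremal F →
    (∀ X → F X ≡ ℱ[ 𝒮 , h ] X) →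
    (∀ X → Sh F X ≡ ℋ 𝒮 X) →
    (∃[ G ] (T (not (F G)) × sExtremal (insert F G)))
      ⇔ (∃[ S₀ ] (T (𝒮 S₀) × ∃[ X ] (T (𝒬 S₀ (h S₀) X) ×
            (∀ S → T (𝒮 S) → S ≢ S₀ → T (not (𝒬 S (h S) X))))))
lemma17 n F 𝒮 h sperner h⊆ _ s-extremal F≡ℱ Sh≡ℋ = mk⇔
  (λ { (G , G∉F , ext′) →
       let (S₀ , S₀∈𝒮 , G∩S₀≡hS₀) = outside-F (T-not⁻ G∉F)
       in S₀ , S₀∈𝒮 , G , 𝒬⁺ G∩S₀≡hS₀ ,
          λ S S∈𝒮 S≢S₀ → T-not⁺ (extremal⇒unique-cover (T-not⁻ G∉F) ext′ S₀∈𝒮 G∩S₀≡hS₀ S∈𝒮 S≢S₀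
                                   ∘ 𝒬⁻ (h⊆ S S∈𝒮)) })
  (λ { (S₀ , S₀∈𝒮 , X , X∈Q , elsewhere) →
       let X∩S₀≡hS₀ = 𝒬⁻ (h⊆ S₀ S₀∈𝒮) X∈Q
       in X , T-not⁺ (λ X∈F → F-avoids S₀∈𝒮 X∈F X∩S₀≡hS₀) ,
          unique-cover⇒extremal S₀∈𝒮 X∩S₀≡hS₀ (λ S S∈𝒮 S≢S₀ → T-not⁻ (elsewhere S S∈𝒮 S≢S₀) ∘ 𝒬⁺) })
  where open Extension F 𝒮 h sperner h⊆ s-extremal F≡ℱ Sh≡ℋ
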